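{- Let $\kappa\ge 9$ and $k=\kappa+\binom{\kappa}{3}$. There exists a multilinear polynomial $\mathcal{Q}:\{ -1,1\}^k\to\mathbb{R}$ of degree $4$ that $\tfrac18$-separates the Huang predicate $H_\kappa$. Consequently, $H_\kappa$ is $\tfrac18$-far from supporting a $4$-wise uniform distribution.
   Context: Index $z\in\{ -1,1\}^k$, $k=\kappa+\binom{\kappa}{3}$, by coordinates $z_1,\dots,z_\kappa$ and $z_T$ for each $3$-element subset $T\subseteq[\kappa]$. $z$ strongly satisfies the Huang predicate if $z_{\{i,j,\ell\}}=z_iz_jz_\ell$ for all distinct $i,j,\ell\in[\kappa]$; $z$ satisfies it if there is $z'$ that strongly satisfies it with Hamming distance between $z$ and $z'$ at most $\kappa$. $H_\kappa(z)=1$ if $z$ satisfies the Huang predicate and $0$ otherwise. For $P:\{ -1,1\}^k\to\{0,1\}$ and $0<\delta<1$, a multilinear polynomial $Q$ (written $Q(z)=\sum_S\widehat Q(S)\prod_{i\in S}z_i$) $\delta$-separates $P$ if $Q(z)\ge\delta-1$ for all $z$, $Q(z)\ge\delta$ for all $z\in P^{ -1}(1)$, and $\widehat Q(\emptyset)=0$. A distribution on $\{ -1,1\}^k$ is $t$-wise uniform if every marginal on $t$ coordinates is uniform; $P$ is $\delta$-far from supporting a $t$-wise uniform distribution if every $t$-wise uniform distribution puts mass at least $\delta$ on $P^{ -1}(0)$.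
   Formalization: The 4-wise uniform distributions in the farness claim take only rational probabilities, and the coefficients of the separating polynomial of degree 4 are taken in the rationals. -}

module Defs where

open import Data.Bool using (Bool; true; false; if_then_else_; _xor_; _∧_; _∨_; not)
open import Data.Nat as ℕ using (ℕ; zero; suc; _≤ᵇ_; _≡ᵇ_)
open import Data.Nat.Combinatorics using (_C_)
open import Data.Integer using (+_)
open import Data.Fin using (Fin; zero; suc; _↑ˡ_; _↑ʳ_)
open import Data.Fin.Subset using (Subset; inside; outside; ∣_∣) renaming (⊥ to ∅)
open import Data.Vec as Vec using (Vec; []; _∷_)
open import Data.Vec.Functional using () renaming (_∷_ to _◂_)
open import Data.List as List using (List; []; _∷_; concatMap; length; foldr)
open import Data.Rational using (ℚ; 0ℚ; 1ℚ; ½; _+_; _*_; _/_; -_)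
open import Function using (_∘_)
open import Data.Product using (Σ; _×_)
open import Relation.Binary.PropositionalEquality using (_≡_)
open import Relation.Nullary using (¬_)
open import Data.Rational using (_≤_; _-_)

-- A point is a function  z : Fin n → Bool ; the bit b encodes the sign
-- (-1)^b, i.e.  false ↦ +1,  true ↦ -1.  Hence products of coordinates
-- correspond to xor of bits.

Point : ℕ → Set
Point n = Fin n → Bool

sgn : Bool → ℚ
sgn false = 1ℚ
sgn true  = - 1ℚ

allPoints : (n : ℕ) → List (Point n)
allPoints zero    = (λ ()) ∷ []
allPoints (suc n) = concatMap (λ f → (false ◂ f) ∷ (true ◂ f) ∷ []) (allPoints n)

allSubsets : (n : ℕ) → List (Subset n)
allSubsets zero    = [] ∷ []
allSubsets (suc n) = concatMap (λ S → (outside ∷ S) ∷ (inside ∷ S) ∷ []) (allSubsets n)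

sumℚ : {A : Set} → List A → (A → ℚ) → ℚ
sumℚ xs f = foldr (λ x acc → f x + acc) 0ℚ xs

-- xor of the bits of z over the coordinates in S
-- (so  sgn (parity S z) = ∏_{i ∈ S} z_i  in ±1 notation)
parity : {n : ℕ} → Subset n → Point n → Bool
parity {zero}  []      z = false
parity {suc n} (b ∷ S) z = (b ∧ z zero) xor parity S (z ∘ suc)

hamming : {n : ℕ} → Point n → Point n → ℕ
hamming {zero}  z z' = 0
hamming {suc n} z z' =
  (if z zero xor z' zero then 1 else 0) ℕ.+ hamming (z ∘ suc) (z' ∘ suc)

-- Multilinear polynomials over ℚ on {-1,1}^n, given by their Fourier
-- coefficients  Q̂ : Subset n → ℚ :   Q(z) = Σ_S Q̂(S) ∏_{i∈S} z_i.

evalPoly : {n : ℕ} → (Subset n → ℚ) → Point n → ℚ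
evalPoly {n} Q̂ z = sumℚ (allSubsets n) (λ S → Q̂ S * sgn (parity S z))

HasDegree : {n : ℕ} → (Subset n → ℚ) → ℕ → Set
HasDegree {n} Q̂ d =
  ((S : Subset n) → d ℕ.< ∣ S ∣ → Q̂ S ≡ 0ℚ) ×
  (Σ (Subset n) λ S → ∣ S ∣ ≡ d × ¬ (Q̂ S ≡ 0ℚ))

-- The k = κ + m coordinates (m = number of 3-subsets of [κ]) are laid out
-- as: the first κ coordinates are z_1..z_κ, the last m coordinates are
-- z_T for T ranging over the 3-element subsets of Fin κ (enumerated by
-- the list  triples κ ).

triples : (κ : ℕ) → List (Subset κ)
triples κ = List.filterᵇ (λ T → ∣ T ∣ ≡ᵇ 3) (allSubsets κ)

numTriples : ℕ → ℕ
numTriples κ = length (triples κ)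

-- k = κ + binom(κ,3)  (numTriples κ is provably κ C 3)
arity : ℕ → ℕ
arity κ = κ ℕ.+ numTriples κ

triple : (κ : ℕ) → Fin (numTriples κ) → Subset κ
triple κ = List.lookup (triples κ)

singCoord : (κ : ℕ) → Fin κ → Fin (arity κ)
singCoord κ i = i ↑ˡ numTriples κ

tripCoord : (κ : ℕ) → Fin (numTriples κ) → Fin (arity κ)
tripCoord κ t = κ ↑ʳ t

singPart : (κ : ℕ) → Point (arity κ) → Point κ
singPart κ z = z ∘ singCoord κ

allFinᵇ : {n : ℕ} → (Fin n → Bool) → Bool
allFinᵇ {zero}  p = true
allFinᵇ {suc n} p = p zero ∧ allFinᵇ (p ∘ suc)

anyᵇ : {A : Set} → (A → Bool) → List A → Bool
anyᵇ p = foldr (λ x acc → p x ∨ acc) false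

_==_ : Bool → Bool → Bool
a == b = not (a xor b)

StronglySatᵇ : (κ : ℕ) → Point (arity κ) → Bool
StronglySatᵇ κ z =
  allFinᵇ (λ t → z (tripCoord κ t) == parity (triple κ t) (singPart κ z))

Huang : (κ : ℕ) → Point (arity κ) → Bool
Huang κ z =
  anyᵇ (λ z' → StronglySatᵇ κ z' ∧ (hamming z z' ≤ᵇ κ)) (allPoints (arity κ))

record Separates {n : ℕ} (δ : ℚ) (P : Point n → Bool) (Q̂ : Subset n → ℚ) : Set where
  field
    lowerAll  : (z : Point n) → δ - 1ℚ ≤ evalPoly Q̂ z
    lowerSat  : (z : Point n) → P z ≡ true → δ ≤ evalPoly Q̂ z
    noConst   : Q̂ ∅ ≡ 0ℚ

agreeOn : {n : ℕ} → Subset n → Point n → Point n → Bool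
agreeOn {zero}  []      a z = true
agreeOn {suc n} (b ∷ S) a z =
  (not b ∨ (a zero == z zero)) ∧ agreeOn S (a ∘ suc) (z ∘ suc)

halfPow : ℕ → ℚ
halfPow zero    = 1ℚ
halfPow (suc t) = ½ * halfPow t

record TWiseUniform {n : ℕ} (t : ℕ) (D : Point n → ℚ) : Set where
  field
    nonneg   : (z : Point n) → 0ℚ ≤ D z
    total    : sumℚ (allPoints n) D ≡ 1ℚ
    marginal : (S : Subset n) → ∣ S ∣ ≡ t → (a : Point n) →
               sumℚ (allPoints n) (λ z → if agreeOn S a z then D z else 0ℚ)
                 ≡ halfPow t

massOnZeros : {n : ℕ} → (Point n → Bool) → (Point n → ℚ) → ℚ
massOnZeros {n} P D = sumℚ (allPoints n) (λ z → if P z then 0ℚ else D z)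

FarFromTWise : {n : ℕ} → ℚ → ℕ → (Point n → Bool) → Set
FarFromTWise {n} δ t P =
  (D : Point n → ℚ) → TWiseUniform t D → δ ≤ massOnZeros P D

{-# OPTIONS --safe #-}
-- Call four 3-subsets of [κ] an even quadruple if every point lies in an even number of them;
-- then the four coordinates z_T of a strongly satisfying point multiply to 1. Given L even
-- quadruples with 4L distinct triples, let Q = (7/8)/L · Σ_q χ_q, the sum of the corresponding
-- degree-4 characters. Always Q ≥ -7/8. If z is within distance κ of a strongly satisfying z′,
-- then χ_q(z) ≠ χ_q(z′) = 1 only if q contains a coordinate where z and z′ differ; as the
-- quadruples are disjoint, at most κ characters are -1 and Q(z) ≥ 7/8 - (7/4)κ/L, which is
-- at least 1/8 once 7κ ≤ 3L. For κ = 9 the 84 triples split into 21 even quadruples, and each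
-- further point p adds the three quadruples {p} ∪ e, e running over the edges of three
-- edge-disjoint 4-cycles on earlier points, so L = 21 + 3(κ - 9). Finally Q is homogeneous of
-- degree 4, so it has expectation 0 under every 4-wise uniform distribution, which must
-- therefore put mass at least 1/8 where H_κ vanishes.
module Submission where

module SeparatingPolynomials where

  open import Defs
  open import Algebra.Bundles using (CommutativeMonoid; CommutativeRing; Ring)
  import Algebra.Properties.CommutativeSemigroup as CommutativeSemigroupProperties
  import Algebra.Properties.Semiring.Mult
  open import Data.Bool using (Bool; true; false; if_then_else_; _xor_; _∧_; not)
  import Data.Bool.Properties as Bool
  open import Data.Empty using (⊥; ⊥-elim)
  open import Data.Fin using (Fin; zero; suc)
  import Data.Fin.Properties as Fin
  open import Data.Fin.Subset using (Subset; outside; inside; ⁅_⁆; ∣_∣) renaming (⊥ to ∅)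
  open import Data.Fin.Subset.Properties using (∣⊥∣≡0; x∈⁅y⁆⇒x≡y)
  import Data.Integer as ℤ
  open import Data.List using (List; []; _∷_; _++_; map; concat; concatMap; length; foldr; allFin)
  import Data.List.Properties as List
  open import Data.List.Membership.Propositional using (_∈_; _∉_)
  open import Data.List.Membership.Propositional.Properties using (∈-concatMap⁺; ∈-allFin; ∈-map⁺)
  import Data.List.Membership.DecPropositional as DecMembership
  open import Data.List.Relation.Binary.Subset.Propositional using (_⊆_)
  open import Data.List.Relation.Unary.All as All using (All; []; _∷_)
  import Data.List.Relation.Unary.All.Properties as All
  open import Data.List.Relation.Unary.AllPairs using ([]; _∷_)
  open import Data.List.Relation.Unary.Any as Any using (here; there)
  open import Data.List.Relation.Unary.Unique.Propositional using (Unique)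
  open import Data.List.Relation.Unary.Unique.Propositional.Properties using (Unique[x∷xs]⇒x∉xs; allFin⁺)
  open import Data.Nat as ℕ using (ℕ; zero; suc)
  import Data.Nat.Properties as ℕₚ
  open import Data.Product using (Σ; ∃-syntax; _×_; _,_; proj₁; proj₂)
  open import Data.Rational
    using (ℚ; 0ℚ; 1ℚ; ½; _+_; _*_; -_; _-_; _≤_; _<_; _/_; 1/_; Positive; NonZero; nonNegative; positive)
  import Data.Rational.Properties as ℚ
  open import Data.Rational.Solver using (module +-*-Solver)
  open import Data.Vec using ([]; _∷_; lookup)
  import Data.Vec as Vec
  import Data.Vec.Properties as Vec
  open import Data.Vec.Functional using (zipWith) renaming (_∷_ to _◂_)
  open import Function using (_∘_; id)
  open import Relation.Binary.Definitions using (DecidableEquality)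
  open import Relation.Binary.PropositionalEquality
  open import Relation.Nullary.Decidable using (does; yes; no; dec-true; dec-false; decidable-stable)
  open import Relation.Nullary.Negation using (¬_)

  open +-*-Solver using (solve; _:=_; _:+_; _:*_; _:-_; con)
  open CommutativeSemigroupProperties (CommutativeMonoid.commutativeSemigroup ℚ.+-0-commutativeMonoid)
    using () renaming (interchange to +-interchange)
  open CommutativeSemigroupProperties (CommutativeRing.+-commutativeSemigroup Bool.xor-∧-commutativeRing)
    using () renaming (interchange to xor-interchange)
  open Algebra.Properties.Semiring.Mult (Ring.semiring ℚ.+-*-ring)
    using (×-assoc-*; ×1-homo-*) renaming (_×_ to _·_)

  private variable
    A B : Set
    n : ℕ
    x : A
    xs ys : List A
    f g : A → ℚ

  sumℚ-cong : (xs : List A) → (∀ x → f x ≡ g x) → sumℚ xs f ≡ sumℚ xs g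
  sumℚ-cong []       f≗g = refl
  sumℚ-cong (x ∷ xs) f≗g = cong₂ _+_ (f≗g x) (sumℚ-cong xs f≗g)

  sumℚ-mono : (xs : List A) → (∀ {x} → x ∈ xs → f x ≤ g x) → sumℚ xs f ≤ sumℚ xs g
  sumℚ-mono []       f≤g = ℚ.≤-refl
  sumℚ-mono (x ∷ xs) f≤g = ℚ.+-mono-≤ (f≤g (here refl)) (sumℚ-mono xs (f≤g ∘ there))

  sumℚ-++ : (xs ys : List A) (f : A → ℚ) → sumℚ (xs ++ ys) f ≡ sumℚ xs f + sumℚ ys f
  sumℚ-++ []       ys f = sym (ℚ.+-identityˡ _)
  sumℚ-++ (x ∷ xs) ys f = trans (cong (f x +_) (sumℚ-++ xs ys f)) (sym (ℚ.+-assoc (f x) _ _))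

  sumℚ-map : (h : A → B) (xs : List A) (f : B → ℚ) → sumℚ (map h xs) f ≡ sumℚ xs (f ∘ h)
  sumℚ-map h []       f = refl
  sumℚ-map h (x ∷ xs) f = cong (f (h x) +_) (sumℚ-map h xs f)

  sumℚ-concat : (xss : List (List A)) (f : A → ℚ) → sumℚ (concat xss) f ≡ sumℚ xss (λ xs → sumℚ xs f)
  sumℚ-concat []         f = refl
  sumℚ-concat (xs ∷ xss) f =
    trans (sumℚ-++ xs (concat xss) f) (cong (sumℚ xs f +_) (sumℚ-concat xss f))

  sumℚ-concatMap : (h : A → List B) (xs : List A) (f : B → ℚ) →
                   sumℚ (concatMap h xs) f ≡ sumℚ xs (λ x → sumℚ (h x) f)
  sumℚ-concatMap h xs f = trans (sumℚ-concat (map h xs) f) (sumℚ-map h xs (λ ys → sumℚ ys f))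

  sumℚ-+ : (xs : List A) (f g : A → ℚ) → sumℚ xs (λ x → f x + g x) ≡ sumℚ xs f + sumℚ xs g
  sumℚ-+ []       f g = refl
  sumℚ-+ (x ∷ xs) f g =
    trans (cong (f x + g x +_) (sumℚ-+ xs f g)) (+-interchange (f x) (g x) _ _)

  sumℚ-*ˡ : (xs : List A) (c : ℚ) (f : A → ℚ) → sumℚ xs (λ x → c * f x) ≡ c * sumℚ xs f
  sumℚ-*ˡ []       c f = sym (ℚ.*-zeroʳ c)
  sumℚ-*ˡ (x ∷ xs) c f =
    trans (cong (c * f x +_) (sumℚ-*ˡ xs c f)) (sym (ℚ.*-distribˡ-+ c (f x) _))

  sumℚ-*ʳ : (xs : List A) (f : A → ℚ) (c : ℚ) → sumℚ xs f * c ≡ sumℚ xs (λ x → f x * c)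
  sumℚ-*ʳ xs f c = begin
    sumℚ xs f * c              ≡⟨ ℚ.*-comm _ c ⟩
    c * sumℚ xs f              ≡⟨ sumℚ-*ˡ xs c f ⟨
    sumℚ xs (λ x → c * f x)    ≡⟨ sumℚ-cong xs (λ x → ℚ.*-comm c (f x)) ⟩
    sumℚ xs (λ x → f x * c)    ∎
    where open ≡-Reasoning

  sumℚ-neg : (xs : List A) (f : A → ℚ) → sumℚ xs (λ x → - f x) ≡ - sumℚ xs f
  sumℚ-neg []       f = refl
  sumℚ-neg (x ∷ xs) f =
    trans (cong (- f x +_) (sumℚ-neg xs f)) (sym (ℚ.neg-distrib-+ (f x) _))

  sumℚ-const : (xs : List A) (c : ℚ) → sumℚ xs (λ _ → c) ≡ length xs · c
  sumℚ-const []       c = refl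
  sumℚ-const (x ∷ xs) c = cong (c +_) (sumℚ-const xs c)

  sumℚ-zero : (xs : List A) → sumℚ xs (λ _ → 0ℚ) ≡ 0ℚ
  sumℚ-zero []       = refl
  sumℚ-zero (x ∷ xs) = cong (0ℚ +_) (sumℚ-zero xs)

  sumℚ-swap : (xs : List A) (ys : List B) (f : A → B → ℚ) →
              sumℚ xs (λ x → sumℚ ys (f x)) ≡ sumℚ ys (λ y → sumℚ xs (λ x → f x y))
  sumℚ-swap []       ys f = sym (sumℚ-zero ys)
  sumℚ-swap (x ∷ xs) ys f =
    trans (cong (sumℚ ys (f x) +_) (sumℚ-swap xs ys f)) (sym (sumℚ-+ ys (f x) _))

  sumℚ-if-false : (xs : List A) (p : A → Bool) (f : A → ℚ) → (∀ {x} → x ∈ xs → p x ≡ false) →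
                  sumℚ xs (λ x → if p x then f x else 0ℚ) ≡ 0ℚ
  sumℚ-if-false []       p f p≡false = refl
  sumℚ-if-false (x ∷ xs) p f p≡false rewrite p≡false (here refl) =
    trans (ℚ.+-identityˡ _) (sumℚ-if-false xs p f (p≡false ∘ there))

  sumℚ-nonNeg : (xs : List A) → (∀ x → 0ℚ ≤ f x) → 0ℚ ≤ sumℚ xs f
  sumℚ-nonNeg xs f≥0 = ℚ.≤-trans (ℚ.≤-reflexive (sym (sumℚ-zero xs))) (sumℚ-mono xs (λ _ → f≥0 _))

  term≤sumℚ : (xs : List A) → (∀ x → 0ℚ ≤ f x) → x ∈ xs → f x ≤ sumℚ xs f
  term≤sumℚ {f = f} (y ∷ ys) f≥0 (here refl) =
    ℚ.≤-trans (ℚ.≤-reflexive (sym (ℚ.+-identityʳ (f y)))) (ℚ.+-monoʳ-≤ (f y) (sumℚ-nonNeg ys f≥0))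
  term≤sumℚ {f = f} (y ∷ ys) f≥0 (there x∈ys) =
    ℚ.≤-trans (term≤sumℚ ys f≥0 x∈ys)
              (ℚ.≤-trans (ℚ.≤-reflexive (sym (ℚ.+-identityˡ _))) (ℚ.+-monoˡ-≤ _ (f≥0 y)))

  module _ (_≟_ : DecidableEquality A) where

    sumℚ-δ : (f : A → ℚ) → Unique xs → x ∈ xs →
             sumℚ xs (λ y → if does (y ≟ x) then f y else 0ℚ) ≡ f x
    sumℚ-δ {xs = y ∷ ys} {x} f (y∉ys ∷ ys!) x∈ with y ≟ x
    ... | yes refl = trans (cong (f y +_) (sumℚ-if-false ys _ f y′≢y)) (ℚ.+-identityʳ (f y))
      where
      y′≢y : ∀ {y′} → y′ ∈ ys → does (y′ ≟ y) ≡ false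
      y′≢y y′∈ys = dec-false (_ ≟ y) (All.lookup y∉ys y′∈ys ∘ sym)
    ... | no y≢x = trans (ℚ.+-identityˡ _) (sumℚ-δ f ys! (Any.tail (y≢x ∘ sym) x∈))

    sumℚ-δ-≤ : (c : ℚ) → 0ℚ ≤ c → (y : A) → Unique xs →
               sumℚ xs (λ x → if does (y ≟ x) then c else 0ℚ) ≤ c
    sumℚ-δ-≤ {xs = []}     c c≥0 y []           = c≥0
    sumℚ-δ-≤ {xs = x ∷ xs} c c≥0 y (x∉xs ∷ xs!) with y ≟ x
    ... | yes refl = ℚ.≤-reflexive (trans (cong (c +_) (sumℚ-if-false xs _ _ y≢x′)) (ℚ.+-identityʳ c))
      where
      y≢x′ : ∀ {x′} → x′ ∈ xs → does (y ≟ x′) ≡ false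
      y≢x′ x′∈xs = dec-false (y ≟ _) (All.lookup x∉xs x′∈xs)
    ... | no _ = ℚ.≤-trans (ℚ.≤-reflexive (ℚ.+-identityˡ _)) (sumℚ-δ-≤ c c≥0 y xs!)

    sumℚ-mono-⊆ : {f : A → ℚ} {xs ys : List A} →
                  (∀ x → 0ℚ ≤ f x) → Unique xs → Unique ys → xs ⊆ ys → sumℚ xs f ≤ sumℚ ys f
    sumℚ-mono-⊆ {f} {xs} {ys} f≥0 xs! ys! xs⊆ys = begin
      sumℚ xs f                                     ≡⟨ expand xs xs⊆ys ⟩
      sumℚ xs (λ x → sumℚ ys (kronecker x))         ≡⟨ sumℚ-swap xs ys kronecker ⟩
      sumℚ ys (λ y → sumℚ xs (λ x → kronecker x y))
        ≤⟨ sumℚ-mono ys (λ {y} _ → sumℚ-δ-≤ (f y) (f≥0 y) y xs!) ⟩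
      sumℚ ys f                                     ∎
      where
      open ℚ.≤-Reasoning
      kronecker : A → A → ℚ
      kronecker x y = if does (y ≟ x) then f y else 0ℚ
      expand : ∀ xs′ → xs′ ⊆ ys → sumℚ xs′ f ≡ sumℚ xs′ (λ x → sumℚ ys (kronecker x))
      expand []        _   = refl
      expand (x ∷ xs′) ⊆ys = cong₂ _+_ (sym (sumℚ-δ f ys! (⊆ys (here refl)))) (expand xs′ (⊆ys ∘ there))

  Unique-++⁻ˡ : (xs : List A) → Unique (xs ++ ys) → Unique xs
  Unique-++⁻ˡ []       _              = []
  Unique-++⁻ˡ (x ∷ xs) (x∉ ∷ xs++ys!) = All.++⁻ˡ xs x∉ ∷ Unique-++⁻ˡ xs xs++ys!

  Unique-++⁻ʳ : (xs : List A) → Unique (xs ++ ys) → Unique ys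
  Unique-++⁻ʳ []       ys!           = ys!
  Unique-++⁻ʳ (x ∷ xs) (_ ∷ xs++ys!) = Unique-++⁻ʳ xs xs++ys!

  Unique-concat⁻ : (xss : List (List A)) → Unique (concat xss) → All Unique xss
  Unique-concat⁻ []         _   = []
  Unique-concat⁻ (xs ∷ xss) xss! = Unique-++⁻ˡ xs xss! ∷ Unique-concat⁻ xss (Unique-++⁻ʳ xs xss!)

  map-preimage : {h : A → B} {ys : List B} → All (λ y → ∃[ x ] h x ≡ y) ys → ∃[ xs ] map h xs ≡ ys
  map-preimage []                 = [] , refl
  map-preimage ((x , refl) ∷ hxs) = let (xs , eq) = map-preimage hxs in x ∷ xs , cong (_ ∷_) eq

  nonEmpty-member : (xs : List A) .{{_ : ℕ.NonZero (length xs)}} → ∃[ x ] x ∈ xs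
  nonEmpty-member (x ∷ _) = x , here refl

  ∈-allSubsets : (S : Subset n) → S ∈ allSubsets n
  ∈-allSubsets []      = here refl
  ∈-allSubsets (b ∷ S) = ∈-concatMap⁺ pair (Any.map (λ { refl → ∈-pair b }) (∈-allSubsets S))
    where
    pair : Subset _ → List (Subset _)
    pair S = (outside ∷ S) ∷ (inside ∷ S) ∷ []
    ∈-pair : ∀ b → (b ∷ S) ∈ pair S
    ∈-pair false = here refl
    ∈-pair true  = there (here refl)

  allSubsets-unique : (n : ℕ) → Unique (allSubsets n)
  allSubsets-unique zero    = [] ∷ []
  allSubsets-unique (suc n) = unique-step (allSubsets-unique n)
    where
    pair : Subset n → List (Subset (suc n))
    pair S = (outside ∷ S) ∷ (inside ∷ S) ∷ []
    fresh : ∀ {S Ss} b → All (S ≢_) Ss → All ((b ∷ S) ≢_) (concatMap pair Ss)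
    fresh b S∉ = All.concat⁺ (All.map⁺ (All.map (λ S≢ → ≢-tail S≢ ∷ ≢-tail S≢ ∷ []) S∉))
      where
      ≢-tail : ∀ {S S′ b′} → S ≢ S′ → (b ∷ S) ≢ (b′ ∷ S′)
      ≢-tail S≢S′ = S≢S′ ∘ Vec.∷-injectiveʳ
    unique-step : ∀ {Ss} → Unique Ss → Unique (concatMap pair Ss)
    unique-step []         = []
    unique-step (S∉ ∷ Ss!) = ((λ ()) ∷ fresh outside S∉) ∷ fresh inside S∉ ∷ unique-step Ss!

  sumℚ-allPoints-suc : (f : Point (suc n) → ℚ) →
                       sumℚ (allPoints (suc n)) f ≡ sumℚ (allPoints n) (λ z → f (false ◂ z) + f (true ◂ z))
  sumℚ-allPoints-suc {n} f = trans (sumℚ-concatMap (λ z → (false ◂ z) ∷ (true ◂ z) ∷ []) (allPoints n) f)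
    (sumℚ-cong (allPoints n) (λ z → cong (f (false ◂ z) +_) (ℚ.+-identityʳ (f (true ◂ z)))))

  sumℚ-allFin-suc : (f : Fin (suc n) → ℚ) → sumℚ (allFin (suc n)) f ≡ f zero + sumℚ (allFin n) (f ∘ suc)
  sumℚ-allFin-suc {n} f = cong (f zero +_)
    (trans (cong (λ xs → sumℚ xs f) (sym (List.map-tabulate id suc))) (sumℚ-map suc (allFin n) f))

  -- Characters

  infixl 6 _⊕_
  _⊕_ : Subset n → Subset n → Subset n
  _⊕_ = Vec.zipWith _xor_

  ⨁ : List (Subset n) → Subset n
  ⨁ = foldr _⊕_ ∅

  xorAll : List Bool → Bool
  xorAll = foldr _xor_ false

  χ : Subset n → Point n → ℚ
  χ S z = sgn (parity S z)

  𝟙 : Bool → ℚ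
  𝟙 b = if b then 1ℚ else 0ℚ

  parity-⊕ : (S T : Subset n) (z : Point n) → parity (S ⊕ T) z ≡ parity S z xor parity T z
  parity-⊕ []      []      z = refl
  parity-⊕ (a ∷ S) (b ∷ T) z = trans
    (cong₂ _xor_ (Bool.∧-distribʳ-xor (z zero) a b) (parity-⊕ S T (z ∘ suc)))
    (xor-interchange (a ∧ z zero) (b ∧ z zero) _ _)

  parity-zipWith-xor : (S : Subset n) (z z′ : Point n) →
                       parity S (zipWith _xor_ z z′) ≡ parity S z xor parity S z′
  parity-zipWith-xor []      z z′ = refl
  parity-zipWith-xor (b ∷ S) z z′ = trans
    (cong₂ _xor_ (Bool.∧-distribˡ-xor b (z zero) (z′ zero)) (parity-zipWith-xor S (z ∘ suc) (z′ ∘ suc)))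
    (xor-interchange (b ∧ z zero) (b ∧ z′ zero) _ _)

  parity-zipWith-even : (S : Subset n) (z z′ : Point n) → parity S z′ ≡ false →
                        parity S z ≡ parity S (zipWith _xor_ z z′)
  parity-zipWith-even S z z′ z′-even = begin
    parity S z                      ≡⟨ Bool.xor-identityʳ _ ⟨
    parity S z xor false            ≡⟨ cong (parity S z xor_) z′-even ⟨
    parity S z xor parity S z′      ≡⟨ parity-zipWith-xor S z z′ ⟨
    parity S (zipWith _xor_ z z′)   ∎
    where open ≡-Reasoning

  parity-∅ : (z : Point n) → parity ∅ z ≡ false
  parity-∅ {zero}  z = refl
  parity-∅ {suc n} z = parity-∅ (z ∘ suc)

  parity-⁅⁆ : (x : Fin n) (z : Point n) → parity ⁅ x ⁆ z ≡ z x
  parity-⁅⁆ zero    z = trans (cong (z zero xor_) (parity-∅ (z ∘ suc))) (Bool.xor-identityʳ (z zero))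
  parity-⁅⁆ (suc x) z = parity-⁅⁆ x (z ∘ suc)

  parity-⨁ : (Ss : List (Subset n)) (z : Point n) → parity (⨁ Ss) z ≡ xorAll (map (λ S → parity S z) Ss)
  parity-⨁ []       z = parity-∅ z
  parity-⨁ (S ∷ Ss) z = trans (parity-⊕ S (⨁ Ss) z) (cong (parity S z xor_) (parity-⨁ Ss z))

  sgn-not : ∀ b → sgn (not b) ≡ - sgn b
  sgn-not true  = refl
  sgn-not false = refl

  *sgn≡-𝟙 : (w : ℚ) (b : Bool) → w * sgn b ≡ w - (w + w) * 𝟙 b
  *sgn≡-𝟙 w true  = solve 1 (λ w → w :* con (- 1ℚ) := w :- (w :+ w) :* con 1ℚ) refl w
  *sgn≡-𝟙 w false = solve 1 (λ w → w :* con 1ℚ := w :- (w :+ w) :* con 0ℚ) refl w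

  -w≤*sgn : (w : ℚ) → 0ℚ ≤ w → (b : Bool) → - w ≤ w * sgn b
  -w≤*sgn w w≥0 true  = ℚ.≤-reflexive (trans (cong -_ (sym (ℚ.*-identityʳ w))) (ℚ.neg-distribʳ-* w 1ℚ))
  -w≤*sgn w w≥0 false =
    ℚ.≤-trans (ℚ.neg-antimono-≤ w≥0) (ℚ.≤-trans w≥0 (ℚ.≤-reflexive (sym (ℚ.*-identityʳ w))))

  𝟙-nonNeg : ∀ b → 0ℚ ≤ 𝟙 b
  𝟙-nonNeg true  = ℚ.nonNegative⁻¹ 1ℚ
  𝟙-nonNeg false = ℚ.≤-refl

  𝟙-xorAll≤ : (bs : List Bool) → 𝟙 (xorAll bs) ≤ sumℚ bs 𝟙
  𝟙-xorAll≤ []       = ℚ.≤-refl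
  𝟙-xorAll≤ (b ∷ bs) = ℚ.≤-trans (𝟙-xor≤ b (xorAll bs)) (ℚ.+-monoʳ-≤ (𝟙 b) (𝟙-xorAll≤ bs))
    where
    𝟙-xor≤ : ∀ a b → 𝟙 (a xor b) ≤ 𝟙 a + 𝟙 b
    𝟙-xor≤ true  true  = ℚ.nonNegative⁻¹ (1ℚ + 1ℚ)
    𝟙-xor≤ true  false = ℚ.≤-refl
    𝟙-xor≤ false b     = ℚ.≤-reflexive (sym (ℚ.+-identityˡ (𝟙 b)))

  hamming-sumℚ : (z z′ : Point n) → sumℚ (allFin n) (λ x → 𝟙 (z x xor z′ x)) ≡ hamming z z′ · 1ℚ
  hamming-sumℚ {zero}  z z′ = refl
  hamming-sumℚ {suc n} z z′ = begin
    sumℚ (allFin (suc n)) (λ x → 𝟙 (z x xor z′ x))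
      ≡⟨ sumℚ-allFin-suc (λ x → 𝟙 (z x xor z′ x)) ⟩
    𝟙 (z zero xor z′ zero) + sumℚ (allFin n) (λ x → 𝟙 (z (suc x) xor z′ (suc x)))
      ≡⟨ cong (𝟙 (z zero xor z′ zero) +_) (hamming-sumℚ (z ∘ suc) (z′ ∘ suc)) ⟩
    𝟙 (z zero xor z′ zero) + hamming (z ∘ suc) (z′ ∘ suc) · 1ℚ
      ≡⟨ step (z zero xor z′ zero) _ ⟩
    hamming z z′ · 1ℚ ∎
    where
    open ≡-Reasoning
    step : ∀ b h → 𝟙 b + h · 1ℚ ≡ ((if b then 1 else 0) ℕ.+ h) · 1ℚ
    step true  h = refl
    step false h = ℚ.+-identityˡ (h · 1ℚ)

  ⟦_⟧ : List (Fin n) → Subset n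
  ⟦ B ⟧ = ⨁ (map ⁅_⁆ B)

  parity-⟦⟧ : (B : List (Fin n)) (z : Point n) → parity ⟦ B ⟧ z ≡ xorAll (map z B)
  parity-⟦⟧ []      z = parity-∅ z
  parity-⟦⟧ (x ∷ B) z = trans (parity-⊕ ⁅ x ⁆ ⟦ B ⟧ z) (cong₂ _xor_ (parity-⁅⁆ x z) (parity-⟦⟧ B z))

  ⊕-identityˡ : (S : Subset n) → ∅ ⊕ S ≡ S
  ⊕-identityˡ S = trans (Vec.zipWith-replicate₁ _xor_ false S) (Vec.map-id S)

  lookup-⁅⁆ : {x y : Fin n} → x ≢ y → lookup ⁅ x ⁆ y ≡ false
  lookup-⁅⁆ x≢y = Bool.¬-not (λ eq → x≢y (sym (x∈⁅y⁆⇒x≡y _ (Vec.lookup⇒[]= _ _ eq))))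

  lookup-⟦⟧ : {y : Fin n} (B : List (Fin n)) → y ∉ B → lookup ⟦ B ⟧ y ≡ false
  lookup-⟦⟧ {y = y} []      y∉B = Vec.lookup-replicate y false
  lookup-⟦⟧ {y = y} (x ∷ B) y∉B = trans (Vec.lookup-zipWith _xor_ y ⁅ x ⁆ ⟦ B ⟧)
    (cong₂ _xor_ (lookup-⁅⁆ (λ x≡y → y∉B (here (sym x≡y)))) (lookup-⟦⟧ B (y∉B ∘ there)))

  ∣⁅⁆⊕∣ : (x : Fin n) (S : Subset n) → lookup S x ≡ false → ∣ ⁅ x ⁆ ⊕ S ∣ ≡ suc ∣ S ∣
  ∣⁅⁆⊕∣ zero    (false ∷ S) _   = cong (suc ∘ ∣_∣) (⊕-identityˡ S)
  ∣⁅⁆⊕∣ (suc x) (false ∷ S) x∉S = ∣⁅⁆⊕∣ x S x∉S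
  ∣⁅⁆⊕∣ (suc x) (true  ∷ S) x∉S = cong suc (∣⁅⁆⊕∣ x S x∉S)

  ∣⟦⟧∣ : (B : List (Fin n)) → Unique B → ∣ ⟦ B ⟧ ∣ ≡ length B
  ∣⟦⟧∣ {n} []      _             = ∣⊥∣≡0 n
  ∣⟦⟧∣     (x ∷ B) B!@(_ ∷ B′!) =
    trans (∣⁅⁆⊕∣ x ⟦ B ⟧ (lookup-⟦⟧ B (Unique[x∷xs]⇒x∉xs B!))) (cong suc (∣⟦⟧∣ B B′!))

  -- Characters under t-wise uniform distributions

  sumℚ-χ : (S : Subset n) → S ≢ ∅ → sumℚ (allPoints n) (χ S) ≡ 0ℚ
  sumℚ-χ         []            S≢∅ = ⊥-elim (S≢∅ refl)
  sumℚ-χ {suc n} (outside ∷ S) S≢∅ = begin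
    sumℚ (allPoints (suc n)) (χ (outside ∷ S))           ≡⟨ sumℚ-allPoints-suc (χ (outside ∷ S)) ⟩
    sumℚ (allPoints n) (λ z → χ S z + χ S z)             ≡⟨ sumℚ-+ (allPoints n) (χ S) (χ S) ⟩
    sumℚ (allPoints n) (χ S) + sumℚ (allPoints n) (χ S)  ≡⟨ cong₂ _+_ S-sum S-sum ⟩
    0ℚ                                                   ∎
    where
    open ≡-Reasoning
    S-sum = sumℚ-χ S (S≢∅ ∘ cong (outside ∷_))
  sumℚ-χ {suc n} (inside ∷ S)  _   = trans (sumℚ-allPoints-suc (χ (inside ∷ S)))
    (trans (sumℚ-cong (allPoints n) (λ z → sgn+sgn-not (parity S z))) (sumℚ-zero (allPoints n)))
    where
    sgn+sgn-not : ∀ b → sgn b + sgn (not b) ≡ 0ℚ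
    sgn+sgn-not true  = refl
    sgn+sgn-not false = refl

  -- the reciprocal of the number of points that agree with a given point on S
  freeWeight : Subset n → ℚ
  freeWeight []            = 1ℚ
  freeWeight (outside ∷ S) = ½ * freeWeight S
  freeWeight (inside  ∷ S) = freeWeight S

  agreeOn-average : (S : Subset n) (z : Point n) →
                    freeWeight S * sumℚ (allPoints n) (λ a → if agreeOn S a z then χ S a else 0ℚ) ≡ χ S z
  agreeOn-average []                    z = refl
  agreeOn-average {suc n} (outside ∷ S) z = begin
    ½ * freeWeight S * sumℚ (allPoints (suc n)) summand
      ≡⟨ cong (½ * freeWeight S *_) (trans (sumℚ-allPoints-suc summand) (sumℚ-+ (allPoints n) agreeing agreeing)) ⟩
    ½ * freeWeight S * (sumℚ (allPoints n) agreeing + sumℚ (allPoints n) agreeing)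
      ≡⟨ solve 2 (λ w s → con ½ :* w :* (s :+ s) := w :* s) refl (freeWeight S) (sumℚ (allPoints n) agreeing) ⟩
    freeWeight S * sumℚ (allPoints n) agreeing
      ≡⟨ agreeOn-average S (z ∘ suc) ⟩
    χ S (z ∘ suc) ∎
    where
    open ≡-Reasoning
    summand : Point (suc n) → ℚ
    summand a = if agreeOn (outside ∷ S) a z then χ (outside ∷ S) a else 0ℚ
    agreeing : Point n → ℚ
    agreeing a = if agreeOn S a (z ∘ suc) then χ S a else 0ℚ
  agreeOn-average {suc n} (inside ∷ S) z = split (z zero) (z ∘ suc)
    where
    open ≡-Reasoning
    agreeing : Point n → Point n → ℚ
    agreeing z′ a = if agreeOn S a z′ then χ S a else 0ℚ
    summand : Bool → Point n → Point (suc n) → ℚ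
    summand z₀ z′ a = if agreeOn (inside ∷ S) a (z₀ ◂ z′) then χ (inside ∷ S) a else 0ℚ
    flip : ∀ b a → (if b then sgn (not (parity S a)) else 0ℚ) ≡ - (if b then χ S a else 0ℚ)
    flip true  a = sgn-not (parity S a)
    flip false a = refl
    split : ∀ z₀ z′ → freeWeight S * sumℚ (allPoints (suc n)) (summand z₀ z′) ≡ χ (inside ∷ S) (z₀ ◂ z′)
    split false z′ = begin
      freeWeight S * sumℚ (allPoints (suc n)) (summand false z′)
        ≡⟨ cong (freeWeight S *_) (sumℚ-allPoints-suc (summand false z′)) ⟩
      freeWeight S * sumℚ (allPoints n) (λ a → agreeing z′ a + 0ℚ)
        ≡⟨ cong (freeWeight S *_) (sumℚ-cong (allPoints n) (λ a → ℚ.+-identityʳ (agreeing z′ a))) ⟩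
      freeWeight S * sumℚ (allPoints n) (agreeing z′)
        ≡⟨ agreeOn-average S z′ ⟩
      χ S z′ ∎
    split true  z′ = begin
      freeWeight S * sumℚ (allPoints (suc n)) (summand true z′)
        ≡⟨ cong (freeWeight S *_) (sumℚ-allPoints-suc (summand true z′)) ⟩
      freeWeight S * sumℚ (allPoints n) (λ a → 0ℚ + (if agreeOn S a z′ then sgn (not (parity S a)) else 0ℚ))
        ≡⟨ cong (freeWeight S *_)
                (sumℚ-cong (allPoints n) (λ a → trans (ℚ.+-identityˡ _) (flip (agreeOn S a z′) a))) ⟩
      freeWeight S * sumℚ (allPoints n) (λ a → - agreeing z′ a)
        ≡⟨ cong (freeWeight S *_) (sumℚ-neg (allPoints n) (agreeing z′)) ⟩
      freeWeight S * - sumℚ (allPoints n) (agreeing z′)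
        ≡⟨ ℚ.neg-distribʳ-* (freeWeight S) _ ⟨
      - (freeWeight S * sumℚ (allPoints n) (agreeing z′))
        ≡⟨ cong -_ (agreeOn-average S z′) ⟩
      - χ S z′
        ≡⟨ sgn-not (parity S z′) ⟨
      sgn (not (parity S z′)) ∎

  -- Averaging over the points that agree with z on S leaves χ S z unchanged; summed against D,
  -- these averages only see the marginals of D on S, which are uniform.
  TWiseUniform⇒uncorrelated : {t : ℕ} {D : Point n → ℚ} → TWiseUniform t D →
                              (S : Subset n) → ∣ S ∣ ≡ t → S ≢ ∅ →
                              sumℚ (allPoints n) (λ z → D z * χ S z) ≡ 0ℚ
  TWiseUniform⇒uncorrelated {n} {t} {D} D-uniform S ∣S∣≡t S≢∅ = begin
    sumℚ points (λ z → D z * χ S z)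
      ≡⟨ sumℚ-cong points (λ z → cong (D z *_) (sym (agreeOn-average S z))) ⟩
    sumℚ points (λ z → D z * (freeWeight S * average z))
      ≡⟨ sumℚ-cong points (λ z → rearrange (D z) (freeWeight S) (average z)) ⟩
    sumℚ points (λ z → freeWeight S * (D z * average z))
      ≡⟨ sumℚ-*ˡ points (freeWeight S) (λ z → D z * average z) ⟩
    freeWeight S * sumℚ points (λ z → D z * average z)
      ≡⟨ cong (freeWeight S *_) marginals ⟩
    freeWeight S * 0ℚ
      ≡⟨ ℚ.*-zeroʳ (freeWeight S) ⟩
    0ℚ ∎
    where
    open ≡-Reasoning
    points = allPoints n
    rearrange : ∀ d w s → d * (w * s) ≡ w * (d * s)
    rearrange = solve 3 (λ d w s → d :* (w :* s) := w :* (d :* s)) refl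
    agreeing : Point n → Point n → ℚ
    agreeing a z = if agreeOn S a z then χ S a else 0ℚ
    average : Point n → ℚ
    average z = sumℚ points (λ a → agreeing a z)
    move : ∀ a z b → D z * (if b then χ S a else 0ℚ) ≡ χ S a * (if b then D z else 0ℚ)
    move a z true  = ℚ.*-comm (D z) (χ S a)
    move a z false = trans (ℚ.*-zeroʳ (D z)) (sym (ℚ.*-zeroʳ (χ S a)))
    marginals : sumℚ points (λ z → D z * average z) ≡ 0ℚ
    marginals = begin
      sumℚ points (λ z → D z * sumℚ points (λ a → agreeing a z))
        ≡⟨ sumℚ-cong points (λ z → sym (sumℚ-*ˡ points (D z) (λ a → agreeing a z))) ⟩
      sumℚ points (λ z → sumℚ points (λ a → D z * agreeing a z))
        ≡⟨ sumℚ-swap points points (λ z a → D z * agreeing a z) ⟩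
      sumℚ points (λ a → sumℚ points (λ z → D z * agreeing a z))
        ≡⟨ sumℚ-cong points (λ a → trans (sumℚ-cong points (λ z → move a z (agreeOn S a z)))
                                         (sumℚ-*ˡ points (χ S a) (λ z → if agreeOn S a z then D z else 0ℚ))) ⟩
      sumℚ points (λ a → χ S a * sumℚ points (λ z → if agreeOn S a z then D z else 0ℚ))
        ≡⟨ sumℚ-cong points (λ a → cong (χ S a *_) (TWiseUniform.marginal D-uniform S ∣S∣≡t a)) ⟩
      sumℚ points (λ a → χ S a * halfPow t)
        ≡⟨ sumℚ-*ʳ points (χ S) (halfPow t) ⟨
      sumℚ points (χ S) * halfPow t
        ≡⟨ cong (_* halfPow t) (sumℚ-χ S S≢∅) ⟩
      0ℚ * halfPow t
        ≡⟨ ℚ.*-zeroˡ (halfPow t) ⟩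
      0ℚ ∎

  Homogeneous : ℕ → (Subset n → ℚ) → Set
  Homogeneous {n} t Q̂ = (S : Subset n) → ¬ Q̂ S ≡ 0ℚ → ∣ S ∣ ≡ t

  homogeneous-vanishes : {t : ℕ} {Q̂ : Subset n → ℚ} → Homogeneous t Q̂ →
                         (S : Subset n) → ∣ S ∣ ≢ t → Q̂ S ≡ 0ℚ
  homogeneous-vanishes {Q̂ = Q̂} hom S ∣S∣≢t = decidable-stable (Q̂ S ℚ.≟ 0ℚ) (∣S∣≢t ∘ hom S)

  homogeneous⇒uncorrelated : {t : ℕ} {Q̂ : Subset n → ℚ} {D : Point n → ℚ} →
                             Homogeneous (suc t) Q̂ → TWiseUniform (suc t) D →
                             sumℚ (allPoints n) (λ z → D z * evalPoly Q̂ z) ≡ 0ℚ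
  homogeneous⇒uncorrelated {n} {t} {Q̂} {D} hom D-uniform = begin
    sumℚ points (λ z → D z * sumℚ subsets (λ S → Q̂ S * χ S z))
      ≡⟨ sumℚ-cong points (λ z → trans (sym (sumℚ-*ˡ subsets (D z) (λ S → Q̂ S * χ S z)))
                                       (sumℚ-cong subsets (λ S → rearrange (D z) (Q̂ S) (χ S z)))) ⟩
    sumℚ points (λ z → sumℚ subsets (λ S → Q̂ S * (D z * χ S z)))
      ≡⟨ sumℚ-swap points subsets (λ z S → Q̂ S * (D z * χ S z)) ⟩
    sumℚ subsets (λ S → sumℚ points (λ z → Q̂ S * (D z * χ S z)))
      ≡⟨ sumℚ-cong subsets (λ S → trans (sumℚ-*ˡ points (Q̂ S) (λ z → D z * χ S z)) (vanish S)) ⟩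
    sumℚ subsets (λ _ → 0ℚ)
      ≡⟨ sumℚ-zero subsets ⟩
    0ℚ ∎
    where
    open ≡-Reasoning
    points = allPoints n
    subsets = allSubsets n
    rearrange : ∀ d q x → d * (q * x) ≡ q * (d * x)
    rearrange = solve 3 (λ d q x → d :* (q :* x) := q :* (d :* x)) refl
    E[χ] : Subset n → ℚ
    E[χ] S = sumℚ points (λ z → D z * χ S z)
    vanish : ∀ S → Q̂ S * E[χ] S ≡ 0ℚ
    vanish S with Q̂ S ℚ.≟ 0ℚ
    ... | yes Q̂S≡0 = trans (cong (_* E[χ] S) Q̂S≡0) (ℚ.*-zeroˡ (E[χ] S))
    ... | no  Q̂S≢0 =
      trans (cong (Q̂ S *_) (TWiseUniform⇒uncorrelated D-uniform S (hom S Q̂S≢0) S≢∅)) (ℚ.*-zeroʳ (Q̂ S))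
      where
      S≢∅ : S ≢ ∅
      S≢∅ refl = ℕₚ.1+n≢0 (trans (sym (hom ∅ Q̂S≢0)) (∣⊥∣≡0 n))

  separating⇒far : {δ : ℚ} {t : ℕ} {P : Point n → Bool} {Q̂ : Subset n → ℚ} {D : Point n → ℚ} →
                   Separates δ P Q̂ → TWiseUniform t D →
                   sumℚ (allPoints n) (λ z → D z * evalPoly Q̂ z) ≡ 0ℚ → δ ≤ massOnZeros P D
  separating⇒far {n} {δ} {t} {P} {Q̂} {D} separates D-uniform E[Q]≡0 = begin
    δ
      ≡⟨ solve 2 (λ δ m → δ := (δ :- m) :+ m) refl δ mass ⟩
    δ - mass + mass
      ≡⟨ cong (_+ mass) δ-mass ⟨
    sumℚ points (λ z → δ * D z - zeroMass z) + mass
      ≤⟨ ℚ.+-monoˡ-≤ mass (sumℚ-mono points (λ {z} _ → pointwise z)) ⟩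
    sumℚ points (λ z → D z * evalPoly Q̂ z) + mass
      ≡⟨ trans (cong (_+ mass) E[Q]≡0) (ℚ.+-identityˡ mass) ⟩
    mass ∎
    where
    open ℚ.≤-Reasoning
    open Separates separates
    open TWiseUniform D-uniform
    points = allPoints n
    mass = massOnZeros P D
    zeroMass : Point n → ℚ
    zeroMass z = if P z then 0ℚ else D z
    δ-mass : sumℚ points (λ z → δ * D z - zeroMass z) ≡ δ - mass
    δ-mass = begin-equality
      sumℚ points (λ z → δ * D z - zeroMass z)
        ≡⟨ sumℚ-+ points (λ z → δ * D z) (λ z → - zeroMass z) ⟩
      sumℚ points (λ z → δ * D z) + sumℚ points (λ z → - zeroMass z)
        ≡⟨ cong₂ _+_ (trans (sumℚ-*ˡ points δ D) (trans (cong (δ *_) total) (ℚ.*-identityʳ δ)))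
                     (sumℚ-neg points zeroMass) ⟩
      δ - mass ∎
    pointwise : ∀ z → δ * D z - zeroMass z ≤ D z * evalPoly Q̂ z
    pointwise z with P z in Pz
    ... | true  = ℚ.≤-trans (ℚ.≤-reflexive (trans (ℚ.+-identityʳ _) (ℚ.*-comm δ (D z))))
                            (ℚ.*-monoˡ-≤-nonNeg (D z) {{nonNegative (nonneg z)}} (lowerSat z Pz))
    ... | false = ℚ.≤-trans (ℚ.≤-reflexive (solve 2 (λ d δ → δ :* d :- d := d :* (δ :- con 1ℚ)) refl (D z) δ))
                            (ℚ.*-monoˡ-≤-nonNeg (D z) {{nonNegative (nonneg z)}} (lowerAll z))

  _≟ₛ_ : DecidableEquality (Subset n)
  _≟ₛ_ = Vec.≡-dec Bool._≟_

  charPoly : List (Subset n) → ℚ → Subset n → ℚ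
  charPoly Ss w S = sumℚ Ss (λ T → if does (S ≟ₛ T) then w else 0ℚ)

  evalPoly-charPoly : (Ss : List (Subset n)) (w : ℚ) (z : Point n) →
                      evalPoly (charPoly Ss w) z ≡ sumℚ Ss (λ T → w * χ T z)
  evalPoly-charPoly {n} Ss w z = begin
    sumℚ subsets (λ S → charPoly Ss w S * χ S z)
      ≡⟨ sumℚ-cong subsets (λ S → trans (sumℚ-*ʳ Ss (λ T → if does (S ≟ₛ T) then w else 0ℚ) (χ S z))
                                        (sumℚ-cong Ss (λ T → if-* (does (S ≟ₛ T)) (χ S z)))) ⟩
    sumℚ subsets (λ S → sumℚ Ss (λ T → if does (S ≟ₛ T) then w * χ S z else 0ℚ))
      ≡⟨ sumℚ-swap subsets Ss (λ S T → if does (S ≟ₛ T) then w * χ S z else 0ℚ) ⟩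
    sumℚ Ss (λ T → sumℚ subsets (λ S → if does (S ≟ₛ T) then w * χ S z else 0ℚ))
      ≡⟨ sumℚ-cong Ss (λ T → sumℚ-δ _≟ₛ_ (λ S → w * χ S z) (allSubsets-unique n) (∈-allSubsets T)) ⟩
    sumℚ Ss (λ T → w * χ T z) ∎
    where
    open ≡-Reasoning
    subsets = allSubsets n
    if-* : ∀ b c → (if b then w else 0ℚ) * c ≡ (if b then w * c else 0ℚ)
    if-* true  c = refl
    if-* false c = ℚ.*-zeroˡ c

  charPoly-homogeneous : {t : ℕ} (Ss : List (Subset n)) (w : ℚ) → All (λ S → ∣ S ∣ ≡ t) Ss →
                         Homogeneous t (charPoly Ss w)
  charPoly-homogeneous Ss w ∣Ss∣≡t S Q̂S≢0 = All.lookup ∣Ss∣≡t (decidable-stable (S ∈? Ss) S∉Ss⇒Q̂S≡0)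
    where
    open DecMembership _≟ₛ_ using (_∈?_)
    S∉Ss⇒Q̂S≡0 : S ∉ Ss → ⊥
    S∉Ss⇒Q̂S≡0 S∉Ss = Q̂S≢0 (sumℚ-if-false Ss (λ T → does (S ≟ₛ T)) (λ _ → w)
                              (λ T∈Ss → dec-false (S ≟ₛ _) (λ { refl → S∉Ss T∈Ss })))

  charPoly-pos : (Ss : List (Subset n)) {w : ℚ} → 0ℚ < w → {T : Subset n} → T ∈ Ss → 0ℚ < charPoly Ss w T
  charPoly-pos Ss {w} 0<w {T} T∈Ss =
    ℚ.<-≤-trans 0<w (ℚ.≤-trans (ℚ.≤-reflexive (sym w≡term)) (term≤sumℚ Ss term≥0 T∈Ss))
    where
    w≡term : (if does (T ≟ₛ T) then w else 0ℚ) ≡ w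
    w≡term rewrite dec-true (T ≟ₛ T) refl = refl
    term≥0 : ∀ T′ → 0ℚ ≤ (if does (T ≟ₛ T′) then w else 0ℚ)
    term≥0 T′ with does (T ≟ₛ T′)
    ... | true  = ℚ.<⇒≤ 0<w
    ... | false = ℚ.≤-refl

  charSum-lower : {w : ℚ} → 0ℚ ≤ w → (Ss : List (Subset n)) (z : Point n) →
                  - (length Ss · w) ≤ sumℚ Ss (λ T → w * χ T z)
  charSum-lower {w = w} w≥0 Ss z = begin
    - (length Ss · w)          ≡⟨ cong -_ (sumℚ-const Ss w) ⟨
    - sumℚ Ss (λ _ → w)        ≡⟨ sumℚ-neg Ss (λ _ → w) ⟨
    sumℚ Ss (λ _ → - w)        ≤⟨ sumℚ-mono Ss (λ {T} _ → -w≤*sgn w w≥0 (parity T z)) ⟩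
    sumℚ Ss (λ T → w * χ T z)  ∎
    where open ℚ.≤-Reasoning

  -*-antimonoʳ : (a : ℚ) {k x y : ℚ} → 0ℚ ≤ k → x ≤ y → a - k * y ≤ a - k * x
  -*-antimonoʳ a {k} k≥0 x≤y =
    ℚ.+-monoʳ-≤ a (ℚ.neg-antimono-≤ (ℚ.*-monoˡ-≤-nonNeg k {{nonNegative k≥0}} x≤y))

  -- A block's character can differ at z and z′ only if the block contains a coordinate where
  -- z and z′ differ; as the blocks are disjoint, at most hamming z z′ characters do.
  blockSum-near : {w : ℚ} → 0ℚ ≤ w → (Bs : List (List (Fin n))) → Unique (concat Bs) →
                  {z z′ : Point n} → All (λ B → parity ⟦ B ⟧ z′ ≡ false) Bs →
                  length Bs · w - (w + w) * (hamming z z′ · 1ℚ) ≤ sumℚ Bs (λ B → w * χ ⟦ B ⟧ z)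
  blockSum-near {n} {w} w≥0 Bs Bs! {z} {z′} z′-even = begin
    length Bs · w - (w + w) * (hamming z z′ · 1ℚ)
      ≤⟨ -*-antimonoʳ (length Bs · w) 2w≥0 flips≤hamming ⟩
    length Bs · w - (w + w) * sumℚ (concat Bs) (𝟙 ∘ d)
      ≡⟨ cong₂ (λ a b → a - (w + w) * b) (sumℚ-const Bs w) (sym (sumℚ-concat Bs (𝟙 ∘ d))) ⟨
    sumℚ Bs (λ _ → w) - (w + w) * sumℚ Bs flips
      ≡⟨ cong (sumℚ Bs (λ _ → w) +_)
              (trans (sumℚ-neg Bs (λ B → (w + w) * flips B)) (cong -_ (sumℚ-*ˡ Bs (w + w) flips))) ⟨
    sumℚ Bs (λ _ → w) + sumℚ Bs (λ B → - ((w + w) * flips B))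
      ≡⟨ sumℚ-+ Bs (λ _ → w) (λ B → - ((w + w) * flips B)) ⟨
    sumℚ Bs (λ B → w - (w + w) * flips B)
      ≤⟨ sumℚ-mono Bs (λ {B} B∈Bs → block {B} (All.lookup z′-even B∈Bs)) ⟩
    sumℚ Bs (λ B → w * χ ⟦ B ⟧ z) ∎
    where
    open ℚ.≤-Reasoning
    d : Point n
    d = zipWith _xor_ z z′
    flips : List (Fin n) → ℚ
    flips B = sumℚ B (𝟙 ∘ d)
    2w≥0 : 0ℚ ≤ w + w
    2w≥0 = ℚ.+-mono-≤ w≥0 w≥0
    flips≤hamming : sumℚ (concat Bs) (𝟙 ∘ d) ≤ hamming z z′ · 1ℚ
    flips≤hamming = ℚ.≤-trans
      (sumℚ-mono-⊆ Fin._≟_ (𝟙-nonNeg ∘ d) Bs! (allFin⁺ n) (λ {x} _ → ∈-allFin x))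
      (ℚ.≤-reflexive (hamming-sumℚ z z′))
    block : ∀ {B} → parity ⟦ B ⟧ z′ ≡ false → w - (w + w) * flips B ≤ w * χ ⟦ B ⟧ z
    block {B} B-even = begin
      w - (w + w) * flips B                ≤⟨ -*-antimonoʳ w 2w≥0 parity≤flips ⟩
      w - (w + w) * 𝟙 (parity ⟦ B ⟧ z)    ≡⟨ *sgn≡-𝟙 w (parity ⟦ B ⟧ z) ⟨
      w * χ ⟦ B ⟧ z                        ∎
      where
      parity≡ : parity ⟦ B ⟧ z ≡ xorAll (map d B)
      parity≡ = trans (parity-zipWith-even ⟦ B ⟧ z z′ B-even) (parity-⟦⟧ B d)
      parity≤flips : 𝟙 (parity ⟦ B ⟧ z) ≤ flips B
      parity≤flips = ℚ.≤-trans (ℚ.≤-reflexive (cong 𝟙 parity≡))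
                               (ℚ.≤-trans (𝟙-xorAll≤ (map d B)) (ℚ.≤-reflexive (sumℚ-map d B 𝟙)))

  ·-nonNeg : (n : ℕ) {x : ℚ} → 0ℚ ≤ x → 0ℚ ≤ n · x
  ·-nonNeg zero    x≥0 = ℚ.≤-refl
  ·-nonNeg (suc n) x≥0 = ℚ.+-mono-≤ x≥0 (·-nonNeg n x≥0)

  ·-monoˡ-≤ : {m n : ℕ} {x : ℚ} → 0ℚ ≤ x → m ℕ.≤ n → m · x ≤ n · x
  ·-monoˡ-≤ {n = n} x≥0 ℕ.z≤n         = ·-nonNeg n x≥0
  ·-monoˡ-≤ {x = x} x≥0 (ℕ.s≤s m≤n)   = ℚ.+-monoʳ-≤ x (·-monoˡ-≤ x≥0 m≤n)

  ·1-pos : (n : ℕ) .{{_ : ℕ.NonZero n}} → 0ℚ < n · 1ℚ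
  ·1-pos (suc n) = ℚ.<-≤-trans (ℚ.positive⁻¹ 1ℚ) (ℚ.≤-trans (ℚ.≤-reflexive (sym (ℚ.+-identityʳ 1ℚ)))
                                                   (ℚ.+-monoʳ-≤ 1ℚ (·-nonNeg n (ℚ.nonNegative⁻¹ 1ℚ))))

  δ : ℚ
  δ = ½ * ½ * ½

  module _ (L : ℕ) .{{_ : ℕ.NonZero L}} where

    private
      N : ℚ
      N = L · 1ℚ
      instance
        N-positive : Positive N
        N-positive = positive (·1-pos L)
        N-nonZero : NonZero N
        N-nonZero = ℚ.pos⇒nonZero N

    weight : ℚ
    weight = 1/ N * (1ℚ - δ)

    weight-pos : 0ℚ < weight
    weight-pos = ℚ.positive⁻¹ weight {{ℚ.pos*pos⇒pos (1/ N) {{ℚ.1/pos⇒pos N}} (1ℚ - δ)}}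

    weight-nonNeg : 0ℚ ≤ weight
    weight-nonNeg = ℚ.<⇒≤ weight-pos

    N*weight : N * weight ≡ 1ℚ - δ
    N*weight = begin
      N * (1/ N * (1ℚ - δ))  ≡⟨ ℚ.*-assoc N (1/ N) (1ℚ - δ) ⟨
      N * 1/ N * (1ℚ - δ)    ≡⟨ cong (_* (1ℚ - δ)) (ℚ.*-inverseʳ N) ⟩
      1ℚ * (1ℚ - δ)          ≡⟨ ℚ.*-identityˡ (1ℚ - δ) ⟩
      1ℚ - δ                 ∎
      where open ≡-Reasoning

    ·weight : L · weight ≡ 1ℚ - δ
    ·weight = trans (cong (L ·_) (sym (ℚ.*-identityˡ weight))) (trans (sym (×-assoc-* L 1ℚ weight)) N*weight)

    -- 7κ ≤ 3L bounds the loss 2κ · weight near a satisfying point by 3/4.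
    weight-near : {κ h : ℕ} → 7 ℕ.* κ ℕ.≤ 3 ℕ.* L → h ℕ.≤ κ →
                  δ ≤ L · weight - (weight + weight) * (h · 1ℚ)
    weight-near {κ} {h} 7κ≤3L h≤κ = begin
      δ                                    ≡⟨⟩
      (1ℚ - δ) - ℤ.+ 3 / 4                 ≤⟨ ℚ.+-monoʳ-≤ (1ℚ - δ) (ℚ.neg-antimono-≤ loss≤3/4) ⟩
      (1ℚ - δ) - (w + w) * (h · 1ℚ)        ≡⟨ cong (_- (w + w) * (h · 1ℚ)) ·weight ⟨
      L · w - (w + w) * (h · 1ℚ)           ∎
      where
      open ℚ.≤-Reasoning
      w = weight
      K = κ · 1ℚ
      7K≤3N : 7 · 1ℚ * K ≤ 3 · 1ℚ * N
      7K≤3N = begin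
        7 · 1ℚ * K          ≡⟨ ×1-homo-* 7 κ ⟨
        (7 ℕ.* κ) · 1ℚ      ≤⟨ ·-monoˡ-≤ (ℚ.nonNegative⁻¹ 1ℚ) 7κ≤3L ⟩
        (3 ℕ.* L) · 1ℚ      ≡⟨ ×1-homo-* 3 L ⟩
        3 · 1ℚ * N          ∎
      loss≤3/4 : (w + w) * (h · 1ℚ) ≤ ℤ.+ 3 / 4
      loss≤3/4 = begin
        (w + w) * (h · 1ℚ)
          ≤⟨ ℚ.*-monoˡ-≤-nonNeg (w + w) {{nonNegative (ℚ.+-mono-≤ weight-nonNeg weight-nonNeg)}}
                                (·-monoˡ-≤ (ℚ.nonNegative⁻¹ 1ℚ) h≤κ) ⟩
        (w + w) * K
          ≡⟨ solve 2 (λ w K → (w :+ w) :* K := con (ℤ.+ 2 / 7) :* ((con (7 · 1ℚ) :* K) :* w)) refl w K ⟩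
        ℤ.+ 2 / 7 * (7 · 1ℚ * K * w)
          ≤⟨ ℚ.*-monoˡ-≤-nonNeg (ℤ.+ 2 / 7) (ℚ.*-monoʳ-≤-nonNeg w {{nonNegative weight-nonNeg}} 7K≤3N) ⟩
        ℤ.+ 2 / 7 * (3 · 1ℚ * N * w)
          ≡⟨ solve 2 (λ N w → con (ℤ.+ 2 / 7) :* ((con (3 · 1ℚ) :* N) :* w) := con (ℤ.+ 6 / 7) :* (N :* w))
                   refl N w ⟩
        ℤ.+ 6 / 7 * (N * w)
          ≡⟨ cong (ℤ.+ 6 / 7 *_) N*weight ⟩
        ℤ.+ 3 / 4 ∎

  blocks⇒separation :
    {n κ : ℕ} (Bs : List (List (Fin n))) → Unique (concat Bs) → All (λ B → length B ≡ 4) Bs →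
    .{{_ : ℕ.NonZero (length Bs)}} → 7 ℕ.* κ ℕ.≤ 3 ℕ.* length Bs → (P : Point n → Bool) →
    (∀ z → P z ≡ true → ∃[ z′ ] All (λ B → parity ⟦ B ⟧ z′ ≡ false) Bs × hamming z z′ ℕ.≤ κ) →
    (Σ (Subset n → ℚ) λ Q̂ → HasDegree Q̂ 4 × Separates δ P Q̂) × FarFromTWise δ 4 P
  blocks⇒separation {n} Bs Bs! four 7κ≤3L P near =
    (Q̂ , degree , separates) ,
    λ D D-uniform → separating⇒far separates D-uniform (homogeneous⇒uncorrelated homogeneous D-uniform)
    where
    L = length Bs
    w = weight L
    Ss = map ⟦_⟧ Bs
    Q̂ = charPoly Ss w

    homogeneous : Homogeneous 4 Q̂
    homogeneous = charPoly-homogeneous Ss w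
      (All.map⁺ (All.zipWith (λ (B! , ∣B∣≡4) → trans (∣⟦⟧∣ _ B!) ∣B∣≡4) (Unique-concat⁻ Bs Bs! , four)))

    degree : HasDegree Q̂ 4
    degree = (λ S 4<∣S∣ → homogeneous-vanishes homogeneous S (ℕₚ.>⇒≢ 4<∣S∣))
           , ⟦ B₀ ⟧ , trans (∣⟦⟧∣ B₀ (All.lookup (Unique-concat⁻ Bs Bs!) B₀∈Bs)) (All.lookup four B₀∈Bs)
           , λ Q̂B₀≡0 → ℚ.<-irrefl (sym Q̂B₀≡0) (charPoly-pos Ss (weight-pos L) (∈-map⁺ ⟦_⟧ B₀∈Bs))
      where
      B₀ = proj₁ (nonEmpty-member Bs)
      B₀∈Bs = proj₂ (nonEmpty-member Bs)

    lowerAll : ∀ z → δ - 1ℚ ≤ evalPoly Q̂ z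
    lowerAll z = begin
      δ - 1ℚ                      ≡⟨ cong -_ (·weight L) ⟨
      - (L · w)                   ≡⟨ cong (λ m → - (m · w)) (List.length-map ⟦_⟧ Bs) ⟨
      - (length Ss · w)           ≤⟨ charSum-lower (weight-nonNeg L) Ss z ⟩
      sumℚ Ss (λ T → w * χ T z)   ≡⟨ evalPoly-charPoly Ss w z ⟨
      evalPoly Q̂ z                ∎
      where open ℚ.≤-Reasoning

    lowerSat : ∀ z → P z ≡ true → δ ≤ evalPoly Q̂ z
    lowerSat z Pz = begin
      δ                                                ≤⟨ weight-near L 7κ≤3L z-near-z′ ⟩
      L · w - (w + w) * (hamming z z′ · 1ℚ)             ≤⟨ blockSum-near (weight-nonNeg L) Bs Bs! z′-even ⟩
      sumℚ Bs (λ B → w * χ ⟦ B ⟧ z)                    ≡⟨ sumℚ-map ⟦_⟧ Bs (λ S → w * χ S z) ⟨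
      sumℚ Ss (λ T → w * χ T z)                        ≡⟨ evalPoly-charPoly Ss w z ⟨
      evalPoly Q̂ z                                     ∎
      where
      open ℚ.≤-Reasoning
      z′ = proj₁ (near z Pz)
      z′-even = proj₁ (proj₂ (near z Pz))
      z-near-z′ = proj₂ (proj₂ (near z Pz))

    separates : Separates δ P Q̂
    separates = record
      { lowerAll = lowerAll
      ; lowerSat = lowerSat
      ; noConst  = homogeneous-vanishes homogeneous ∅ (λ ∣∅∣≡4 → ℕₚ.1+n≢0 (trans (sym ∣∅∣≡4) (∣⊥∣≡0 n)))
      }

module HuangPredicate where

  open import Defs
  open SeparatingPolynomials
  open import Data.Bool using (Bool; true; false; _∨_)
  import Data.Bool.Properties as Bool
  open import Data.Empty using (⊥)
  open import Data.Fin using (Fin; zero; suc; toℕ)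
  import Data.Fin.Properties as Fin
  open import Data.Fin.Subset using (Subset; outside; inside; ∣_∣) renaming (⊥ to ∅)
  open import Data.List using (List; []; _∷_; _++_; map; concat; length; replicate)
  import Data.List.Properties as List
  open import Data.List.Membership.Propositional using (_∈_)
  open import Data.List.Membership.Propositional.Properties using (∈-filter⁺; ∈-map⁻)
  open import Data.List.Relation.Binary.Disjoint.Propositional using (Disjoint)
  open import Data.List.Relation.Unary.All as All using (All; []; _∷_; all?)
  import Data.List.Relation.Unary.All.Properties as All
  open import Data.List.Relation.Unary.Any as Any using ()
  open import Data.List.Relation.Unary.Any.Properties using (lookup-index)
  open import Data.List.Relation.Unary.Unique.Propositional using (Unique)
  import Data.List.Relation.Unary.Unique.Propositional.Properties as Unique
  import Data.List.Relation.Unary.Unique.DecPropositional as UniqueDec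
  open import Data.Nat as ℕ using (ℕ; zero; suc)
  import Data.Nat.Properties as ℕₚ
  open import Data.Nat.Tactic.RingSolver using (solve-∀)
  open import Data.Product using (Σ; ∃-syntax; _×_; _,_; proj₁; proj₂)
  open import Data.Rational using (ℚ)
  open import Data.Vec using (_∷_)
  import Data.Vec as Vec
  import Data.Vec.Properties as Vec
  open import Function using (_∘_)
  open import Function.Bundles using (Equivalence)
  open import Relation.Binary.PropositionalEquality
  open import Relation.Nullary.Decidable using (Dec; T?; from-yes; _×-dec_)

  private variable
    A : Set
    n : ℕ

  StronglySatisfies : (κ : ℕ) → Point (arity κ) → Set
  StronglySatisfies κ z = ∀ t → z (tripCoord κ t) ≡ parity (triple κ t) (singPart κ z)

  anyᵇ-sound : (p : A → Bool) (xs : List A) → anyᵇ p xs ≡ true → ∃[ x ] p x ≡ true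
  anyᵇ-sound p (x ∷ xs) any≡true with p x in px
  ... | true  = x , px
  ... | false = anyᵇ-sound p xs any≡true

  allFinᵇ-sound : (p : Fin n → Bool) → allFinᵇ p ≡ true → ∀ i → p i ≡ true
  allFinᵇ-sound {suc n} p all≡true zero    = Bool.∧-conicalˡ _ _ all≡true
  allFinᵇ-sound {suc n} p all≡true (suc i) = allFinᵇ-sound (p ∘ suc) (Bool.∧-conicalʳ _ _ all≡true) i

  ==⇒≡ : ∀ a b → (a == b) ≡ true → a ≡ b
  ==⇒≡ true  true  _  = refl
  ==⇒≡ false false _  = refl
  ==⇒≡ true  false ()
  ==⇒≡ false true  ()

  Huang-sound : (κ : ℕ) (z : Point (arity κ)) → Huang κ z ≡ true →
                ∃[ z′ ] StronglySatisfies κ z′ × hamming z z′ ℕ.≤ κ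
  Huang-sound κ z Hz with anyᵇ-sound _ (allPoints (arity κ)) Hz
  ... | z′ , sat∧close = z′ , strong , close
    where
    strong : StronglySatisfies κ z′
    strong t = ==⇒≡ _ _ (allFinᵇ-sound _ (Bool.∧-conicalˡ _ _ sat∧close) t)
    close : hamming z z′ ℕ.≤ κ
    close = ℕₚ.≤ᵇ⇒≤ _ κ (Equivalence.from Bool.T-≡ (Bool.∧-conicalʳ _ _ sat∧close))

  strongly-satisfied-parity : {κ : ℕ} {z : Point (arity κ)} → StronglySatisfies κ z →
                              (I : List (Fin (numTriples κ))) → ⨁ (map (triple κ) I) ≡ ∅ →
                              parity ⟦ map (tripCoord κ) I ⟧ z ≡ false
  strongly-satisfied-parity {κ} {z} strong I I-even = begin
    parity ⟦ map (tripCoord κ) I ⟧ z                     ≡⟨ parity-⟦⟧ (map (tripCoord κ) I) z ⟩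
    xorAll (map z (map (tripCoord κ) I))                  ≡⟨ cong xorAll (List.map-∘ I) ⟨
    xorAll (map (z ∘ tripCoord κ) I)                      ≡⟨ cong xorAll (List.map-cong strong I) ⟩
    xorAll (map (λ t → parity (triple κ t) s) I)          ≡⟨ cong xorAll (List.map-∘ I) ⟩
    xorAll (map (λ T → parity T s) (map (triple κ) I))    ≡⟨ parity-⨁ (map (triple κ) I) s ⟨
    parity (⨁ (map (triple κ) I)) s                      ≡⟨ cong (λ S → parity S s) I-even ⟩
    parity ∅ s                                           ≡⟨ parity-∅ s ⟩
    false                                                ∎
    where
    open ≡-Reasoning
    s = singPart κ z

  triple-surjective : {κ : ℕ} {T : Subset κ} → ∣ T ∣ ≡ 3 → ∃[ t ] triple κ t ≡ T
  triple-surjective {κ} {T} ∣T∣≡3 = Any.index T∈triples , sym (lookup-index T∈triples)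
    where
    T∈triples : T ∈ triples κ
    T∈triples = ∈-filter⁺ (T? ∘ λ S → ∣ S ∣ ℕ.≡ᵇ 3) (∈-allSubsets T) (ℕₚ.≡⇒≡ᵇ ∣ T ∣ 3 ∣T∣≡3)

  -- Systems of even quadruples of r-subsets

  EvenQuadruple : {κ : ℕ} → ℕ → List (Subset κ) → Set
  EvenQuadruple r q = length q ≡ 4 × All (λ T → ∣ T ∣ ≡ r) q × ⨁ q ≡ ∅

  record EvenQuadrupleSystem (r κ : ℕ) : Set where
    field
      quadruples : List (List (Subset κ))
      even       : All (EvenQuadruple r) quadruples
      distinct   : Unique (concat quadruples)

    size : ℕ
    size = length quadruples

  open EvenQuadrupleSystem using (quadruples; size)

  evenQuadrupleSystem⇒separation :
    {κ : ℕ} (sys : EvenQuadrupleSystem 3 κ) → .{{_ : ℕ.NonZero (size sys)}} → 7 ℕ.* κ ℕ.≤ 3 ℕ.* size sys →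
    (Σ (Subset (arity κ) → ℚ) λ Q̂ → HasDegree Q̂ 4 × Separates δ (Huang κ) Q̂) × FarFromTWise δ 4 (Huang κ)
  evenQuadrupleSystem⇒separation {κ} sys {{L≢0}} 7κ≤3L =
    blocks⇒separation Bs Bs! four {{subst ℕ.NonZero (sym length-Bs) L≢0}}
                      (subst (λ L → 7 ℕ.* κ ℕ.≤ 3 ℕ.* L) (sym length-Bs) 7κ≤3L) (Huang κ) near
    where
    open EvenQuadrupleSystem sys using (even; distinct)
    indexed : ∃[ Is ] map (map (triple κ)) Is ≡ quadruples sys
    indexed = map-preimage (All.map (λ (_ , ∣q∣≡3 , _) → map-preimage (All.map triple-surjective ∣q∣≡3)) even)
    Is = proj₁ indexed
    Bs = map (map (tripCoord κ)) Is
    length-map² : ∀ {X C D : Set} {g : X → C} {h : X → D} xs → length (map g xs) ≡ length (map h xs)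
    length-map² xs = trans (List.length-map _ xs) (sym (List.length-map _ xs))
    length-Bs : length Bs ≡ size sys
    length-Bs = trans (length-map² Is) (cong length (proj₂ indexed))
    Is-even : All (EvenQuadruple 3 ∘ map (triple κ)) Is
    Is-even = All.map⁻ (subst (All (EvenQuadruple 3)) (sym (proj₂ indexed)) even)
    Is! : Unique (concat Is)
    Is! = Unique.map⁻ (subst Unique (trans (cong concat (sym (proj₂ indexed))) (List.concat-map Is)) distinct)
    Bs! : Unique (concat Bs)
    Bs! = subst Unique (sym (List.concat-map Is)) (Unique.map⁺ (Fin.↑ʳ-injective κ _ _) Is!)
    four : All (λ B → length B ≡ 4) Bs
    four = All.map⁺ (All.map (λ {I} (∣I∣≡4 , _) → trans (length-map² I) ∣I∣≡4) Is-even)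
    near : ∀ z → Huang κ z ≡ true → ∃[ z′ ] All (λ B → parity ⟦ B ⟧ z′ ≡ false) Bs × hamming z z′ ℕ.≤ κ
    near z Hz = let (z′ , strong , close) = Huang-sound κ z Hz in
      z′ , All.map⁺ (All.map (λ {I} (_ , _ , I-even) → strongly-satisfied-parity strong I I-even) Is-even) , close

  module _ {r κ : ℕ} where

    ⨁-map-∷ : (b : Bool) (q : List (Subset κ)) → ⨁ (map (b ∷_) q) ≡ xorAll (replicate (length q) b) ∷ ⨁ q
    ⨁-map-∷ b []      = refl
    ⨁-map-∷ b (S ∷ q) = cong ((b ∷ S) ⊕_) (⨁-map-∷ b q)

    unique-map-∷ : (b : Bool) {qs : List (List (Subset κ))} → Unique (concat qs) →
                   Unique (concat (map (map (b ∷_)) qs))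
    unique-map-∷ b {qs} qs! = subst Unique (sym (List.concat-map qs)) (Unique.map⁺ Vec.∷-injectiveʳ qs!)

    lift : EvenQuadrupleSystem r κ → EvenQuadrupleSystem r (suc κ)
    lift sys = record
      { quadruples = map (map (outside ∷_)) (quadruples sys)
      ; even       = All.map⁺ (All.map lift-even even)
      ; distinct   = unique-map-∷ outside {quadruples sys} distinct
      }
      where
      open EvenQuadrupleSystem sys using (even; distinct)
      lift-even : ∀ {q} → EvenQuadruple r q → EvenQuadruple r (map (outside ∷_) q)
      lift-even {q} (∣q∣≡4 , sizes , ⨁q≡∅) =
        trans (List.length-map _ q) ∣q∣≡4 , All.map⁺ sizes ,
        trans (⨁-map-∷ outside q) (cong₂ (λ m S → xorAll (replicate m false) ∷ S) ∣q∣≡4 ⨁q≡∅)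

    cone : EvenQuadrupleSystem r κ → EvenQuadrupleSystem (suc r) (suc κ)
    cone sys = record
      { quadruples = map (map (inside ∷_)) (quadruples sys)
      ; even       = All.map⁺ (All.map cone-even even)
      ; distinct   = unique-map-∷ inside {quadruples sys} distinct
      }
      where
      open EvenQuadrupleSystem sys using (even; distinct)
      cone-even : ∀ {q} → EvenQuadruple r q → EvenQuadruple (suc r) (map (inside ∷_) q)
      cone-even {q} (∣q∣≡4 , sizes , ⨁q≡∅) =
        trans (List.length-map _ q) ∣q∣≡4 , All.map⁺ (All.map (cong suc) sizes) ,
        trans (⨁-map-∷ inside q) (cong₂ (λ m S → xorAll (replicate m true) ∷ S) ∣q∣≡4 ⨁q≡∅)

    join : (sys sys′ : EvenQuadrupleSystem r κ) → Disjoint (concat (quadruples sys)) (concat (quadruples sys′)) →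
           EvenQuadrupleSystem r κ
    join sys sys′ disjoint = record
      { quadruples = A.quadruples ++ B.quadruples
      ; even       = All.++⁺ A.even B.even
      ; distinct   = subst Unique (List.concat-++ A.quadruples B.quadruples)
                                  (Unique.++⁺ A.distinct B.distinct disjoint)
      }
      where
      module A = EvenQuadrupleSystem sys
      module B = EvenQuadrupleSystem sys′

  extend : {r κ : ℕ} → EvenQuadrupleSystem (suc r) κ → EvenQuadrupleSystem r κ →
           EvenQuadrupleSystem (suc r) (suc κ)
  extend {κ = κ} sys sys′ = join (lift sys) (cone sys′) outside≢inside
    where
    head : ∀ b {T} (qs : List (List (Subset κ))) → T ∈ concat (map (map (b ∷_)) qs) → ∃[ S ] T ≡ b ∷ S
    head b qs T∈ = let (S , _ , T≡) = ∈-map⁻ (b ∷_) (subst (_ ∈_) (List.concat-map qs) T∈) in S , T≡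
    clash : ∀ {T : Subset (suc κ)} → ∃[ S ] T ≡ outside ∷ S → ∃[ S ] T ≡ inside ∷ S → ⊥
    clash (_ , refl) (_ , ())
    outside≢inside : Disjoint (concat (map (map (outside ∷_)) (quadruples sys)))
                              (concat (map (map (inside ∷_)) (quadruples sys′)))
    outside≢inside (T∈₁ , T∈₂) =
      clash (head outside (quadruples sys) T∈₁) (head inside (quadruples sys′) T∈₂)

  size-extend : {r κ : ℕ} (sys : EvenQuadrupleSystem (suc r) κ) (sys′ : EvenQuadrupleSystem r κ) →
                size (extend sys sys′) ≡ size sys ℕ.+ size sys′
  size-extend sys sys′ = trans (List.length-++ (map _ (quadruples sys)))
    (cong₂ ℕ._+_ (List.length-map _ (quadruples sys)) (List.length-map _ (quadruples sys′)))

  tri : ℕ → ℕ → ℕ → Subset n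
  tri a b c = Vec.tabulate λ i → (toℕ i ℕ.≡ᵇ a) ∨ (toℕ i ℕ.≡ᵇ b) ∨ (toℕ i ℕ.≡ᵇ c)

  pair : ℕ → ℕ → Subset n
  pair a b = Vec.tabulate λ i → (toℕ i ℕ.≡ᵇ a) ∨ (toℕ i ℕ.≡ᵇ b)

  evenQuadruple? : {κ : ℕ} (r : ℕ) (q : List (Subset κ)) → Dec (EvenQuadruple r q)
  evenQuadruple? r q = (length q ℕ.≟ 4) ×-dec all? (λ T → ∣ T ∣ ℕ.≟ r) q ×-dec (⨁ q ≟ₛ ∅)

  module _ {κ : ℕ} where
    open UniqueDec (_≟ₛ_ {κ}) using (unique?) public

  -- 21 quadruples containing each of the 84 triples of Fin 9 exactly once
  baseSystem : EvenQuadrupleSystem 3 9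
  baseSystem = record
    { quadruples = base
    ; even       = from-yes (all? (evenQuadruple? 3) base)
    ; distinct   = from-yes (unique? (concat base))
    }
    where
    base : List (List (Subset 9))
    base =
      (tri 0 1 2 ∷ tri 0 3 8 ∷ tri 1 3 6 ∷ tri 2 6 8 ∷ []) ∷
      (tri 0 1 6 ∷ tri 0 1 8 ∷ tri 3 5 6 ∷ tri 3 5 8 ∷ []) ∷
      (tri 0 2 4 ∷ tri 0 2 6 ∷ tri 0 4 8 ∷ tri 0 6 8 ∷ []) ∷
      (tri 0 1 4 ∷ tri 0 2 8 ∷ tri 1 3 8 ∷ tri 2 3 4 ∷ []) ∷
      (tri 0 1 3 ∷ tri 0 4 6 ∷ tri 1 5 6 ∷ tri 3 4 5 ∷ []) ∷
      (tri 0 3 6 ∷ tri 0 3 7 ∷ tri 2 5 6 ∷ tri 2 5 7 ∷ []) ∷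
      (tri 0 2 3 ∷ tri 0 4 7 ∷ tri 1 2 3 ∷ tri 1 4 7 ∷ []) ∷
      (tri 0 3 5 ∷ tri 0 5 7 ∷ tri 2 3 8 ∷ tri 2 7 8 ∷ []) ∷
      (tri 0 1 7 ∷ tri 0 3 4 ∷ tri 1 4 6 ∷ tri 3 6 7 ∷ []) ∷
      (tri 0 4 5 ∷ tri 0 6 7 ∷ tri 4 5 8 ∷ tri 6 7 8 ∷ []) ∷
      (tri 0 1 5 ∷ tri 0 2 5 ∷ tri 1 4 8 ∷ tri 2 4 8 ∷ []) ∷
      (tri 0 2 7 ∷ tri 0 5 6 ∷ tri 2 4 6 ∷ tri 4 5 7 ∷ []) ∷
      (tri 0 5 8 ∷ tri 0 7 8 ∷ tri 2 4 5 ∷ tri 2 4 7 ∷ []) ∷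
      (tri 1 2 6 ∷ tri 1 2 8 ∷ tri 4 6 7 ∷ tri 4 7 8 ∷ []) ∷
      (tri 1 4 5 ∷ tri 1 7 8 ∷ tri 4 6 8 ∷ tri 5 6 7 ∷ []) ∷
      (tri 1 2 4 ∷ tri 1 6 7 ∷ tri 2 3 7 ∷ tri 3 4 6 ∷ []) ∷
      (tri 1 2 7 ∷ tri 1 5 8 ∷ tri 2 6 7 ∷ tri 5 6 8 ∷ []) ∷
      (tri 3 4 7 ∷ tri 3 6 8 ∷ tri 4 5 6 ∷ tri 5 7 8 ∷ []) ∷
      (tri 1 3 5 ∷ tri 1 6 8 ∷ tri 2 3 6 ∷ tri 2 5 8 ∷ []) ∷
      (tri 1 2 5 ∷ tri 1 5 7 ∷ tri 2 3 5 ∷ tri 3 5 7 ∷ []) ∷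
      (tri 1 3 4 ∷ tri 1 3 7 ∷ tri 3 4 8 ∷ tri 3 7 8 ∷ []) ∷ []

  -- three edge-disjoint 4-cycles
  cycleSystem : EvenQuadrupleSystem 2 9
  cycleSystem = record
    { quadruples = cycles
    ; even       = from-yes (all? (evenQuadruple? 2) cycles)
    ; distinct   = from-yes (unique? (concat cycles))
    }
    where
    cycles : List (List (Subset 9))
    cycles =
      (pair 0 1 ∷ pair 1 2 ∷ pair 2 3 ∷ pair 0 3 ∷ []) ∷
      (pair 4 5 ∷ pair 5 6 ∷ pair 6 7 ∷ pair 4 7 ∷ []) ∷
      (pair 0 4 ∷ pair 1 4 ∷ pair 1 5 ∷ pair 0 5 ∷ []) ∷ []

  liftedCycles : (m : ℕ) → EvenQuadrupleSystem 2 (9 ℕ.+ m)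
  liftedCycles zero    = cycleSystem
  liftedCycles (suc m) = lift (liftedCycles m)

  design : (m : ℕ) → EvenQuadrupleSystem 3 (9 ℕ.+ m)
  design zero    = baseSystem
  design (suc m) = extend (design m) (liftedCycles m)

  size-liftedCycles : (m : ℕ) → size (liftedCycles m) ≡ 3
  size-liftedCycles zero    = refl
  size-liftedCycles (suc m) = trans (List.length-map _ (quadruples (liftedCycles m))) (size-liftedCycles m)

  size-design : (m : ℕ) → size (design m) ≡ 21 ℕ.+ m ℕ.* 3
  size-design zero    = refl
  size-design (suc m) = begin
    size (extend (design m) (liftedCycles m))    ≡⟨ size-extend (design m) (liftedCycles m) ⟩
    size (design m) ℕ.+ size (liftedCycles m)    ≡⟨ cong₂ ℕ._+_ (size-design m) (size-liftedCycles m) ⟩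
    21 ℕ.+ m ℕ.* 3 ℕ.+ 3                         ≡⟨ ℕₚ.+-assoc 21 (m ℕ.* 3) 3 ⟩
    21 ℕ.+ (m ℕ.* 3 ℕ.+ 3)                       ≡⟨ cong (21 ℕ.+_) (ℕₚ.+-comm (m ℕ.* 3) 3) ⟩
    21 ℕ.+ suc m ℕ.* 3                           ∎
    where open ≡-Reasoning

  design-nonZero : (m : ℕ) → ℕ.NonZero (size (design m))
  design-nonZero m = subst ℕ.NonZero (sym (size-design m)) _

  design-large : (m : ℕ) → 7 ℕ.* (9 ℕ.+ m) ℕ.≤ 3 ℕ.* size (design m)
  design-large m = begin
    7 ℕ.* (9 ℕ.+ m)          ≡⟨ 7[9+m] m ⟩
    63 ℕ.+ 7 ℕ.* m           ≤⟨ ℕₚ.+-monoʳ-≤ 63 (ℕₚ.*-monoˡ-≤ m (ℕₚ.m≤m+n 7 2)) ⟩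
    63 ℕ.+ 9 ℕ.* m           ≡⟨ 3[21+3m] m ⟨
    3 ℕ.* (21 ℕ.+ m ℕ.* 3)   ≡⟨ cong (3 ℕ.*_) (size-design m) ⟨
    3 ℕ.* size (design m)    ∎
    where
    open ℕₚ.≤-Reasoning
    7[9+m] : ∀ m → 7 ℕ.* (9 ℕ.+ m) ≡ 63 ℕ.+ 7 ℕ.* m
    7[9+m] = solve-∀
    3[21+3m] : ∀ m → 3 ℕ.* (21 ℕ.+ m ℕ.* 3) ≡ 63 ℕ.+ 9 ℕ.* m
    3[21+3m] = solve-∀

open import Defs
open import Data.Nat using (ℕ; _≤_)
import Data.Nat.Properties as ℕₚ
open import Data.Fin.Subset using (Subset)
open import Data.Product using (Σ; _×_; _,_)
open import Data.Rational using (ℚ; ½; _*_)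
open import Relation.Binary.PropositionalEquality using (refl)
open HuangPredicate using (evenQuadrupleSystem⇒separation; design; design-nonZero; design-large)

theorem5p3 : (κ : ℕ) → 9 ≤ κ →
    (Σ (Subset (arity κ) → ℚ) λ Q̂ →
       HasDegree Q̂ 4 × Separates (½ * ½ * ½) (Huang κ) Q̂)
    × FarFromTWise (½ * ½ * ½) 4 (Huang κ)
theorem5p3 κ 9≤κ with ℕₚ.m≤n⇒∃[o]m+o≡n 9≤κ
... | m , refl = evenQuadrupleSystem⇒separation (design m) {{design-nonZero m}} (design-large m)
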